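{- Let $k\geq 2$ and let $\mathcal{S}$ be a $k$-uniform local arc in $\mathrm{PG}(2,q)$. For each $S\in\mathcal{S}$ choose an arbitrary point $P_S\in S$ and put $S'=S\setminus\{P_S\}$, $\mathcal{S}'=\{S':S\in\mathcal{S}\}$. (i) If $k>2$, then $\mathcal{S}'$ is a $(k-1)$-uniform local arc. (ii) If $k=2$, write $S'=\{Q_S\}$ and let $\ell_S$ be the line through the two points of $S$. Then $\{(Q_S,\ell_S):S\in\mathcal{S}\}$ is an induced matching in the incidence graph of $\mathrm{PG}(2,q)$.
   Context: $\mathrm{PG}(2,q)$ is the classical projective plane of order $q$. An arc is a set of points no three collinear. A local arc is a collection $\mathcal{S}$ of point sets such that for distinct $S_i,S_j\in\mathcal{S}$, $S_i\cap S_j=\emptyset$ and $S_i\cup S_j$ is an arc; it is $k$-uniform if all members have $k$ points. The incidence graph of $\mathrm{PG}(2,q)$ is the bipartite graph whose parts are the points and the lines, a point being adjacent to a line iff they are incident. An induced matching is a set of pairwise vertex-disjoint edges such that no edge of the graph joins endpoints of two distinct edges of the set. -}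

module Defs where

open import Level using (Level; _⊔_) renaming (suc to lsuc)
open import Data.Nat using (ℕ)
open import Data.Fin using (Fin)
open import Data.List using (List; []; _∷_; length; lookup; removeAt; tabulate; _++_)
open import Data.List.Relation.Unary.All using (All)
open import Data.Product using (_×_; _,_; ∃; Σ; proj₁; proj₂)
open import Data.Sum using (_⊎_; inj₁; inj₂)
open import Data.Empty using (⊥)
open import Relation.Nullary using (¬_)
open import Relation.Binary.Definitions using (Decidable)
open import Relation.Binary.PropositionalEquality using (_≡_; _≢_)
open import Algebra.Bundles using (CommutativeRing)

record FiniteField (q : ℕ) (c ℓ : Level) : Set (lsuc (c ⊔ ℓ)) where
  field
    commRing : CommutativeRing c ℓ
  open CommutativeRing commRing public
  field
    _≟_       : Decidable _≈_
    0≉1       : ¬ (0# ≈ 1#)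
    inverse   : ∀ x → ¬ (x ≈ 0#) → ∃ λ y → (x * y) ≈ 1#
    enum      : Fin q → Carrier
    enum-surj : ∀ x → ∃ λ i → enum i ≈ x
    enum-inj  : ∀ i j → enum i ≈ enum j → i ≡ j

record Graph (v e r : Level) : Set (lsuc (v ⊔ e ⊔ r)) where
  field
    Vertex : Set v
    _≐_    : Vertex → Vertex → Set e
    Adj    : Vertex → Vertex → Set r

record IsInducedMatching {v e r} (G : Graph v e r) {m : ℕ}
         (edge : Fin m → Graph.Vertex G × Graph.Vertex G) : Set (v ⊔ e ⊔ r) where
  open Graph G
  private
    fst : Fin m → Vertex
    fst i = proj₁ (edge i)
    snd : Fin m → Vertex
    snd i = proj₂ (edge i)
  field
    isEdge   : ∀ i → Adj (fst i) (snd i)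
    disj-ff  : ∀ i j → i ≢ j → ¬ (fst i ≐ fst j)
    disj-fs  : ∀ i j → i ≢ j → ¬ (fst i ≐ snd j)
    disj-ss  : ∀ i j → i ≢ j → ¬ (snd i ≐ snd j)
    ind-ff   : ∀ i j → i ≢ j → ¬ Adj (fst i) (fst j)
    ind-fs   : ∀ i j → i ≢ j → ¬ Adj (fst i) (snd j)
    ind-sf   : ∀ i j → i ≢ j → ¬ Adj (snd i) (fst j)
    ind-ss   : ∀ i j → i ≢ j → ¬ Adj (snd i) (snd j)

module PG {q c ℓ} (F : FiniteField q c ℓ) where
  open FiniteField F

  record Triple : Set (c ⊔ ℓ) where
    constructor ⟨_,_,_⟩[_]
    field
      x y z   : Carrier
      nonzero : ¬ ((x ≈ 0#) × (y ≈ 0#) × (z ≈ 0#))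
  open Triple

  -- Points and lines of PG(2,q) are nonzero triples up to nonzero scalars.
  Point : Set (c ⊔ ℓ)
  Point = Triple

  Line : Set (c ⊔ ℓ)
  Line = Triple

  _∼_ : Triple → Triple → Set (c ⊔ ℓ)
  u ∼ w = ∃ λ (t : Carrier) → ¬ (t ≈ 0#) ×
            (x u ≈ t * x w) × (y u ≈ t * y w) × (z u ≈ t * z w)

  Inc : Point → Line → Set ℓ
  Inc P L = ((x L * x P) + (y L * y P)) + (z L * z P) ≈ 0#

  Collinear : Point → Point → Point → Set (c ⊔ ℓ)
  Collinear P Q R = ∃ λ (L : Line) → Inc P L × Inc Q L × Inc R L

  -- A finite point set is represented as a list of points; it is a *set*
  -- when its entries are pairwise distinct (as projective points).
  IsPointSet : List Point → Set (c ⊔ ℓ)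
  IsPointSet S = ∀ (i j : Fin (length S)) → i ≢ j → ¬ (lookup S i ∼ lookup S j)

  IsArc : List Point → Set (c ⊔ ℓ)
  IsArc S = ∀ (i j k : Fin (length S)) → i ≢ j → i ≢ k → j ≢ k →
            ¬ Collinear (lookup S i) (lookup S j) (lookup S k)

  Disjoint : List Point → List Point → Set (c ⊔ ℓ)
  Disjoint S T = ∀ (i : Fin (length S)) (j : Fin (length T)) → ¬ (lookup S i ∼ lookup T j)

  IsLocalArc : List (List Point) → Set (c ⊔ ℓ)
  IsLocalArc 𝒮 = (∀ i → IsPointSet (lookup 𝒮 i)) ×
                 (∀ (i j : Fin (length 𝒮)) → i ≢ j →
                    Disjoint (lookup 𝒮 i) (lookup 𝒮 j) × IsArc (lookup 𝒮 i ++ lookup 𝒮 j))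

  IsUniformLocalArc : ℕ → List (List Point) → Set (c ⊔ ℓ)
  IsUniformLocalArc k 𝒮 = IsLocalArc 𝒮 × (∀ i → length (lookup 𝒮 i) ≡ k)

  IncidenceGraph : Graph (c ⊔ ℓ) (c ⊔ ℓ) ℓ
  IncidenceGraph = record { Vertex = Point ⊎ Line ; _≐_ = eqV ; Adj = adj }
    where
      eqV : Point ⊎ Line → Point ⊎ Line → Set (c ⊔ ℓ)
      eqV (inj₁ P) (inj₁ Q) = P ∼ Q
      eqV (inj₂ L) (inj₂ M) = L ∼ M
      eqV _        _        = Level.Lift _ ⊥
      adj : Point ⊎ Line → Point ⊎ Line → Set ℓ
      adj (inj₁ P) (inj₂ L) = Inc P L
      adj (inj₂ L) (inj₁ P) = Inc P L
      adj _        _        = Level.Lift _ ⊥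

  removeChosen : (𝒮 : List (List Point)) →
                 ((i : Fin (length 𝒮)) → Fin (length (lookup 𝒮 i))) → List (List Point)
  removeChosen 𝒮 choice = tabulate (λ i → removeAt (lookup 𝒮 i) (choice i))

{-# OPTIONS --safe #-}
module Submission where

-- Deleting a point from every member only shrinks it, and each condition defining a local arc
-- (distinct points, disjoint members, no three collinear points in a union of two members) is
-- inherited by subsequences; this gives (i) for every k.
-- If Q_S ∼ Q_T, then S and T are not disjoint.  If Q_S is on ℓ_T, or ℓ_S ∼ ℓ_T, then three or
-- four points of the arc S ∪ T lie on one line.  A line meets an arc in at most two points.

open import Defs
open import Data.Nat as Nat using (ℕ; _≥_; _>_; _∸_; _≤_; pred; z≤n; s≤s)
open import Data.Nat.Properties using (≤-refl; pred[m∸n]≡m∸[1+n])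
open import Data.Fin using (Fin; zero; suc; cast)
open import Data.Fin.Properties using (suc-injective; cast-involutive)
open import Data.List using (List; []; _∷_; length; lookup; removeAt; tabulate; _++_)
open import Data.List.Properties using (length-tabulate; lookup-tabulate; length-removeAt; length-++)
open import Data.List.Membership.Propositional using (_∈_)
open import Data.List.Relation.Unary.All as All using (All; _∷_)
import Data.List.Relation.Unary.All.Properties as Allₚ
open import Data.List.Relation.Unary.Any using (index)
open import Data.List.Relation.Unary.Any.Properties using (lookup-index)
open import Data.List.Relation.Binary.Sublist.Propositional using (_⊆_; _∷_; _∷ʳ_; ⊆-refl; from∈; to∈)
open import Data.List.Relation.Binary.Sublist.Propositional.Properties using (++⁺)
open import Data.Product using (_×_; _,_; proj₁; proj₂)
open import Data.Sum using (inj₁; inj₂)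
open import Data.Empty using (⊥-elim)
open import Function using (_∘_)
open import Function.Definitions using (Injective)
open import Relation.Nullary using (¬_)
open import Relation.Binary.PropositionalEquality
  using (_≡_; _≢_; refl; sym; trans; cong; cong₂; subst; subst₂; module ≡-Reasoning)
import Relation.Binary.Reasoning.Setoid as SetoidReasoning

cast-injective : ∀ {m n} .(eq : m ≡ n) → Injective _≡_ _≡_ (cast eq)
cast-injective eq {i} {j} cast-i≡cast-j = begin
  i                         ≡⟨ sym (cast-involutive (sym eq) eq i) ⟩
  cast (sym eq) (cast eq i) ≡⟨ cong (cast (sym eq)) cast-i≡cast-j ⟩
  cast (sym eq) (cast eq j) ≡⟨ cast-involutive (sym eq) eq j ⟩
  j                         ∎
  where open ≡-Reasoning

module _ {a} {A : Set a} where

  lookup-tabulate′ : ∀ {n} (f : Fin n → A) (i : Fin (length (tabulate f))) →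
                     lookup (tabulate f) i ≡ f (cast (length-tabulate f) i)
  lookup-tabulate′ f i = begin
    lookup (tabulate f) i
      ≡⟨ cong (lookup (tabulate f)) (sym (cast-involutive (sym (length-tabulate f)) (length-tabulate f) i)) ⟩
    lookup (tabulate f) (cast (sym (length-tabulate f)) (cast (length-tabulate f) i))
      ≡⟨ lookup-tabulate f _ ⟩
    f (cast (length-tabulate f) i) ∎
    where open ≡-Reasoning

  removeAt-⊆ : (xs : List A) (i : Fin (length xs)) → removeAt xs i ⊆ xs
  removeAt-⊆ (x ∷ xs) zero    = x ∷ʳ ⊆-refl
  removeAt-⊆ (x ∷ xs) (suc i) = refl ∷ removeAt-⊆ xs i

  ⊆-index : {xs ys : List A} → xs ⊆ ys → Fin (length xs) → Fin (length ys)
  ⊆-index (y ∷ʳ τ) i       = suc (⊆-index τ i)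
  ⊆-index (_ ∷ τ)  zero    = zero
  ⊆-index (_ ∷ τ)  (suc i) = suc (⊆-index τ i)

  ⊆-index-injective : {xs ys : List A} (τ : xs ⊆ ys) → Injective _≡_ _≡_ (⊆-index τ)
  ⊆-index-injective (y ∷ʳ τ)                 = ⊆-index-injective τ ∘ suc-injective
  ⊆-index-injective (_ ∷ τ) {zero}  {zero}  _ = refl
  ⊆-index-injective (_ ∷ τ) {suc i} {suc j} p = cong suc (⊆-index-injective τ (suc-injective p))

  lookup-⊆-index : {xs ys : List A} (τ : xs ⊆ ys) (i : Fin (length xs)) →
                   lookup xs i ≡ lookup ys (⊆-index τ i)
  lookup-⊆-index (y ∷ʳ τ)   i       = lookup-⊆-index τ i
  lookup-⊆-index (refl ∷ τ) zero    = refl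
  lookup-⊆-index (refl ∷ τ) (suc i) = lookup-⊆-index τ i

module _ {q c ℓ} (F : FiniteField q c ℓ) where
  open FiniteField F using (_≈_; _+_; _*_; 0#; setoid; +-cong; *-cong; *-assoc; distribˡ; zeroʳ)
    renaming (refl to ≈-refl; sym to ≈-sym)
  open PG F
  open Triple

  Inc-multiple : ∀ {P L M} → L ∼ M → Inc P M → Inc P L
  Inc-multiple {P} {L} {M} (t , _ , x≈ , y≈ , z≈) P∈M = begin
    ((x L * x P) + (y L * y P)) + (z L * z P)
      ≈⟨ +-cong (+-cong (*-cong x≈ ≈-refl) (*-cong y≈ ≈-refl)) (*-cong z≈ ≈-refl) ⟩
    (((t * x M) * x P) + ((t * y M) * y P)) + ((t * z M) * z P)
      ≈⟨ +-cong (+-cong (*-assoc _ _ _) (*-assoc _ _ _)) (*-assoc _ _ _) ⟩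
    ((t * (x M * x P)) + (t * (y M * y P))) + (t * (z M * z P))
      ≈⟨ +-cong (≈-sym (distribˡ _ _ _)) ≈-refl ⟩
    (t * ((x M * x P) + (y M * y P))) + (t * (z M * z P))
      ≈⟨ ≈-sym (distribˡ _ _ _) ⟩
    t * (((x M * x P) + (y M * y P)) + (z M * z P))
      ≈⟨ *-cong ≈-refl P∈M ⟩
    t * 0#
      ≈⟨ zeroʳ _ ⟩
    0# ∎
    where open SetoidReasoning setoid

  IsPointSet-resp-⊆ : ∀ {xs ys} → xs ⊆ ys → IsPointSet ys → IsPointSet xs
  IsPointSet-resp-⊆ τ set i j i≢j
    rewrite lookup-⊆-index τ i | lookup-⊆-index τ j =
    set (⊆-index τ i) (⊆-index τ j) (i≢j ∘ ⊆-index-injective τ)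

  Disjoint-resp-⊆ : ∀ {xs ys zs ws} → xs ⊆ ys → zs ⊆ ws → Disjoint ys ws → Disjoint xs zs
  Disjoint-resp-⊆ τ σ disjoint i j rewrite lookup-⊆-index τ i | lookup-⊆-index σ j =
    disjoint (⊆-index τ i) (⊆-index σ j)

  IsArc-resp-⊆ : ∀ {xs ys} → xs ⊆ ys → IsArc ys → IsArc xs
  IsArc-resp-⊆ τ arc i j k i≢j i≢k j≢k
    rewrite lookup-⊆-index τ i | lookup-⊆-index τ j | lookup-⊆-index τ k =
    arc (⊆-index τ i) (⊆-index τ j) (⊆-index τ k)
        (i≢j ∘ ⊆-index-injective τ) (i≢k ∘ ⊆-index-injective τ) (j≢k ∘ ⊆-index-injective τ)

  Disjoint⇒≁ : ∀ {xs ys P Q} → Disjoint xs ys → P ∈ xs → Q ∈ ys → ¬ (P ∼ Q)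
  Disjoint⇒≁ disjoint P∈xs Q∈ys =
    disjoint (index P∈xs) (index Q∈ys) ∘ subst₂ _∼_ (lookup-index P∈xs) (lookup-index Q∈ys)

  IsArc-onLine⇒length≤2 : ∀ xs L → IsArc xs → All (λ P → Inc P L) xs → length xs ≤ 2
  IsArc-onLine⇒length≤2 []           _ _ _ = z≤n
  IsArc-onLine⇒length≤2 (_ ∷ [])     _ _ _ = s≤s z≤n
  IsArc-onLine⇒length≤2 (_ ∷ _ ∷ []) _ _ _ = ≤-refl
  IsArc-onLine⇒length≤2 (_ ∷ _ ∷ _ ∷ _) L arc (P∈L ∷ Q∈L ∷ R∈L ∷ _) =
    ⊥-elim (arc zero (suc zero) (suc (suc zero)) (λ ()) (λ ()) (λ ()) (L , P∈L , Q∈L , R∈L))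

  IsLocalArc-tabulate-⊆ : ∀ 𝒮 → IsLocalArc 𝒮 → (f : Fin (length 𝒮) → List Point) →
                          (∀ i → f i ⊆ lookup 𝒮 i) → IsLocalArc (tabulate f)
  IsLocalArc-tabulate-⊆ 𝒮 (sets , pairs) f f⊆𝒮 = sets′ , pairs′
    where
      parent : Fin (length (tabulate f)) → Fin (length 𝒮)
      parent = cast (length-tabulate f)

      member-⊆ : ∀ I → lookup (tabulate f) I ⊆ lookup 𝒮 (parent I)
      member-⊆ I = subst (_⊆ lookup 𝒮 (parent I)) (sym (lookup-tabulate′ f I)) (f⊆𝒮 (parent I))

      sets′ : ∀ I → IsPointSet (lookup (tabulate f) I)
      sets′ I = IsPointSet-resp-⊆ (member-⊆ I) (sets (parent I))

      pairs′ : ∀ I J → I ≢ J → Disjoint (lookup (tabulate f) I) (lookup (tabulate f) J) ×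
                               IsArc (lookup (tabulate f) I ++ lookup (tabulate f) J)
      pairs′ I J I≢J =
        let (disjoint , arc) = pairs (parent I) (parent J) (I≢J ∘ cast-injective (length-tabulate f))
        in Disjoint-resp-⊆ (member-⊆ I) (member-⊆ J) disjoint ,
           IsArc-resp-⊆ (++⁺ (member-⊆ I) (member-⊆ J)) arc

  removeChosen-isUniformLocalArc : ∀ k 𝒮 → IsUniformLocalArc k 𝒮 →
    (choice : (i : Fin (length 𝒮)) → Fin (length (lookup 𝒮 i))) →
    IsUniformLocalArc (k ∸ 1) (removeChosen 𝒮 choice)
  removeChosen-isUniformLocalArc k 𝒮 (localArc , uniform) choice =
    IsLocalArc-tabulate-⊆ 𝒮 localArc S′ (λ i → removeAt-⊆ (lookup 𝒮 i) (choice i)) , uniform′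
    where
      S′ : Fin (length 𝒮) → List Point
      S′ i = removeAt (lookup 𝒮 i) (choice i)

      uniform′ : ∀ I → length (lookup (tabulate S′) I) ≡ k ∸ 1
      uniform′ I = begin
        length (lookup (tabulate S′) I) ≡⟨ cong length (lookup-tabulate′ S′ I) ⟩
        length (S′ i)                   ≡⟨ length-removeAt (lookup 𝒮 i) (choice i) ⟩
        pred (length (lookup 𝒮 i))      ≡⟨ cong pred (uniform i) ⟩
        pred k                          ≡⟨ pred[m∸n]≡m∸[1+n] k 0 ⟩
        k ∸ 1                           ∎
        where
          open ≡-Reasoning
          i = cast (length-tabulate S′) I

  pointLinePairs-isInducedMatching : ∀ 𝒮 → IsUniformLocalArc 2 𝒮 →
    (choice : (i : Fin (length 𝒮)) → Fin (length (lookup 𝒮 i))) →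
    (Q : Fin (length 𝒮) → Point) →
    (∀ i → removeAt (lookup 𝒮 i) (choice i) ≡ Q i ∷ []) →
    (ℓS : Fin (length 𝒮) → Line) →
    (∀ i → All (λ P → Inc P (ℓS i)) (lookup 𝒮 i)) →
    IsInducedMatching IncidenceGraph (λ i → inj₁ (Q i) , inj₂ (ℓS i))
  pointLinePairs-isInducedMatching 𝒮 ((_ , pairs) , uniform) choice Q S′≡Q ℓS S⊆ℓS = record
    { isEdge  = λ i → All.lookup (S⊆ℓS i) (Q∈S i)
    ; disj-ff = λ i j i≢j → Disjoint⇒≁ (proj₁ (pairs i j i≢j)) (Q∈S i) (Q∈S j)
    ; disj-fs = λ _ _ _ ()
    ; disj-ss = ℓS-distinct
    ; ind-ff  = λ _ _ _ ()
    ; ind-fs  = Q∉ℓS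
    ; ind-sf  = λ i j i≢j → Q∉ℓS j i (i≢j ∘ sym)
    ; ind-ss  = λ _ _ _ ()
    }
    where
      S : Fin (length 𝒮) → List Point
      S = lookup 𝒮

      Q∈S : ∀ i → Q i ∈ S i
      Q∈S i = to∈ (subst (_⊆ S i) (S′≡Q i) (removeAt-⊆ (S i) (choice i)))

      Q∉ℓS : ∀ i j → i ≢ j → ¬ Inc (Q i) (ℓS j)
      Q∉ℓS i j i≢j Qi∈ℓSj = three≰two (subst (_≤ 2) (cong Nat.suc (uniform j)) bound)
        where
          three≰two : ¬ (3 ≤ 2)
          three≰two (s≤s (s≤s ()))
          bound : length (Q i ∷ S j) ≤ 2
          bound = IsArc-onLine⇒length≤2 (Q i ∷ S j) (ℓS j)
            (IsArc-resp-⊆ (++⁺ (from∈ (Q∈S i)) ⊆-refl) (proj₂ (pairs i j i≢j)))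
            (Qi∈ℓSj ∷ S⊆ℓS j)

      ℓS-distinct : ∀ i j → i ≢ j → ¬ (ℓS i ∼ ℓS j)
      ℓS-distinct i j i≢j ℓSi∼ℓSj = four≰two (subst (_≤ 2) length-Si++Sj bound)
        where
          four≰two : ¬ (4 ≤ 2)
          four≰two (s≤s (s≤s ()))
          length-Si++Sj : length (S i ++ S j) ≡ 4
          length-Si++Sj = trans (length-++ (S i)) (cong₂ Nat._+_ (uniform i) (uniform j))
          bound : length (S i ++ S j) ≤ 2
          bound = IsArc-onLine⇒length≤2 (S i ++ S j) (ℓS i) (proj₂ (pairs i j i≢j))
            (Allₚ.++⁺ (S⊆ℓS i) (All.map (λ {P} → Inc-multiple {P} {ℓS i} {ℓS j} ℓSi∼ℓSj) (S⊆ℓS j)))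

lemma2p1 : ∀ {q c ℓ} (F : FiniteField q c ℓ) → let open PG F in
    (k : ℕ) → k ≥ 2 → (𝒮 : List (List Point)) → IsUniformLocalArc k 𝒮 →
    (choice : (i : Fin (length 𝒮)) → Fin (length (lookup 𝒮 i))) →
    ((k > 2 → IsUniformLocalArc (k ∸ 1) (removeChosen 𝒮 choice)) ×
     (k ≡ 2 →
       (Q : Fin (length 𝒮) → Point) →
       (∀ i → removeAt (lookup 𝒮 i) (choice i) ≡ Q i ∷ []) →
       (ℓS : Fin (length 𝒮) → Line) →
       (∀ i → All (λ P → Inc P (ℓS i)) (lookup 𝒮 i)) →
       IsInducedMatching IncidenceGraph (λ i → inj₁ (Q i) , inj₂ (ℓS i))))
lemma2p1 F k _ 𝒮 uniformLocalArc choice =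
  (λ _ → removeChosen-isUniformLocalArc F k 𝒮 uniformLocalArc choice) ,
  λ { refl → pointLinePairs-isInducedMatching F 𝒮 uniformLocalArc choice }
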